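{- Let $t\ge s\ge 1$ be integers and let $\mathcal{H}$ be a $3$-graph. Let $G$ be the graph on $V(\mathcal{H})$ whose edges are the pairs $e\in\partial\mathcal{H}$ with $d_{\mathcal{H}}(e)\ge st+s+t$. Then every copy of $K_{s,t}$ in $G$ can be extended to a copy of $K_{s,t}^{+}$ in $\mathcal{H}$ having that copy of $K_{s,t}$ as its core.
   Context: A $3$-graph is a collection of $3$-subsets (edges) of a finite vertex set. $\partial\mathcal{H}$ is the set of $2$-subsets of $V(\mathcal{H})$ contained in some edge of $\mathcal{H}$, and for a pair $e$, $d_{\mathcal{H}}(e)$ is the number of edges of $\mathcal{H}$ containing $e$. For a graph $F$, its expansion $F^{+}$ is the $3$-graph obtained by adding to each edge of $F$ a new vertex, distinct edges receiving distinct new vertices; $F$ is the core of $F^+$. $K_{s,t}$ is the complete bipartite graph with parts of sizes $s$ and $t$. -}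

module Defs where

open import Data.Nat using (ℕ; _+_; _*_; _≤_)
open import Data.Fin using (Fin)
open import Data.Fin.Subset using (Subset; ⁅_⁆; _∪_; _⊆_; ∣_∣)
open import Data.Fin.Subset.Properties using (_⊆?_)
open import Data.List using (List; length; filter)
open import Data.List.Relation.Unary.All using (All)
open import Data.List.Relation.Unary.Unique.Propositional using (Unique)
open import Data.List.Membership.Propositional using (_∈_)
open import Data.Product using (Σ; _×_; ∃)
open import Relation.Binary.PropositionalEquality using (_≡_; _≢_)

record ThreeGraph (n : ℕ) : Set where
  field
    edges  : List (Subset n)
    unique : Unique edges
    size3  : All (λ e → ∣ e ∣ ≡ 3) edges
open ThreeGraph public

pair : ∀ {n} → Fin n → Fin n → Subset n
pair u v = ⁅ u ⁆ ∪ ⁅ v ⁆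

triple : ∀ {n} → Fin n → Fin n → Fin n → Subset n
triple u v w = ⁅ u ⁆ ∪ ⁅ v ⁆ ∪ ⁅ w ⁆

InShadow : ∀ {n} → ThreeGraph n → Fin n → Fin n → Set
InShadow {n} H u v = u ≢ v × Σ (Subset n) (λ f → f ∈ edges H × pair u v ⊆ f)


degree : ∀ {n} → ThreeGraph n → Fin n → Fin n → ℕ
degree H u v = length (filter (λ f → pair u v ⊆? f) (edges H))

GEdge : ∀ {n} → ℕ → ℕ → ThreeGraph n → Fin n → Fin n → Set
GEdge s t H u v = InShadow H u v × s * t + s + t ≤ degree H u v

record KstCopy {n : ℕ} (s t : ℕ) (H : ThreeGraph n) : Set where
  field
    a     : Fin s → Fin n
    b     : Fin t → Fin n
    a-inj : ∀ i i' → a i ≡ a i' → i ≡ i'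
    b-inj : ∀ j j' → b j ≡ b j' → j ≡ j'
    disj  : ∀ i j → a i ≢ b j
    adj   : ∀ i j → GEdge s t H (a i) (b j)
open KstCopy public

record Expansion {n s t : ℕ} (H : ThreeGraph n) (K : KstCopy s t H) : Set where
  field
    c       : Fin s → Fin t → Fin n
    c-inj   : ∀ i j i' j' → c i j ≡ c i' j' → i ≡ i' × j ≡ j'
    c-new-a : ∀ i j i' → c i j ≢ a K i'
    c-new-b : ∀ i j j' → c i j ≢ b K j'
    c-edge  : ∀ i j → triple (a K i) (b K j) (c i j) ∈ edges H

{-# OPTIONS --safe #-}
module Submission where

-- For a pair uv, distinct edges of H through uv have distinct third vertices, so the link of uv
-- has d_H(uv) elements. If uv is an edge of G this is at least st + s + t, and the st new
-- vertices can be chosen greedily: when choosing one of them, only the s + t core vertices and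
-- fewer than st earlier choices are excluded.

open import Defs
open import Data.Nat using (ℕ; suc; _+_; _*_; _≤_; _<_; z<s)
open import Data.Nat.Properties
  using (≤-reflexive; ≤-pred; <-≤-trans; <⇒≱; n<1+n; m<m+n; +-suc; +-comm; +-assoc; module ≤-Reasoning)
open import Data.Fin using (Fin; zero; suc; combine; remQuot)
open import Data.Fin.Properties using (_≟_; any?; combine-injective; remQuot-combine)
open import Data.Fin.Subset using (Subset; ⁅_⁆; _∪_; _⊆_; ∣_∣; inside; outside)
  renaming (_∈_ to _∈ₛ_; _∉_ to _∉ₛ_)
open import Data.Fin.Subset.Properties
  using (_⊆?_; ∪-identityˡ; x∈⁅x⁆; x∈⁅y⁆⇒x≡y; x≢y⇒x∉⁅y⁆; ∣⁅x⁆∣≡1; x∈p∪q⁻; x∈p∪q⁺;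
         ⊆-antisym; p⊆q⇒∣p∣≤∣q∣; p⊂q⇒∣p∣<∣q∣)
  renaming (_∈?_ to _∈ₛ?_)
open import Data.Vec using (_∷_; here; there)
open import Data.List using (List; _∷_; length; filter; map; tabulate; _++_)
open import Data.List.Properties using (filter-notAll; map-∘; map-id-local; length-map; length-tabulate; length-++)
import Data.List.Relation.Unary.All as All
open import Data.List.Relation.Unary.Any using (here; there)
import Data.List.Relation.Unary.Any as Any
open import Data.List.Relation.Unary.AllPairs using (_∷_)
open import Data.List.Relation.Unary.Unique.Propositional using (Unique)
open import Data.List.Relation.Unary.Unique.Propositional.Properties using (map⁻; filter⁺)
open import Data.List.Membership.Propositional using (_∈_; _∉_)
open import Data.List.Membership.Propositional.Properties
  using (∈-filter⁺; ∈-filter⁻; ∈-map⁺; ∈-tabulate⁺; ∈-++⁺ˡ; ∈-++⁺ʳ)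
import Data.List.Membership.DecPropositional as DecMembership
open import Data.Product using (Σ; _×_; ∃; _,_; proj₁; proj₂)
open import Data.Sum using ([_,_]; inj₁; inj₂)
open import Function using (_∘_; Injective)
open import Relation.Binary using (DecidableEquality)
open import Relation.Nullary using (yes; no; ¬?; contradiction)
open import Relation.Nullary.Decidable using (_×-dec_; decidable-stable)
open import Relation.Binary.PropositionalEquality using (_≡_; _≢_; refl; sym; trans; cong; cong₂; subst; subst₂; module ≡-Reasoning)

private
  variable
    n : ℕ
    p q f : Subset n
    u v w x : Fin n

∣⁅x⁆∪p∣≡1+∣p∣ : (x : Fin n) (p : Subset n) → x ∉ₛ p → ∣ ⁅ x ⁆ ∪ p ∣ ≡ suc ∣ p ∣
∣⁅x⁆∪p∣≡1+∣p∣ zero    (outside ∷ p) _   = cong suc (cong ∣_∣ (∪-identityˡ p))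
∣⁅x⁆∪p∣≡1+∣p∣ zero    (inside ∷ p)  x∉p = contradiction here x∉p
∣⁅x⁆∪p∣≡1+∣p∣ (suc x) (outside ∷ p) x∉p = ∣⁅x⁆∪p∣≡1+∣p∣ x p (x∉p ∘ there)
∣⁅x⁆∪p∣≡1+∣p∣ (suc x) (inside ∷ p)  x∉p = cong suc (∣⁅x⁆∪p∣≡1+∣p∣ x p (x∉p ∘ there))

p⊆q∧∣q∣≤∣p∣⇒p≡q : p ⊆ q → ∣ q ∣ ≤ ∣ p ∣ → p ≡ q
p⊆q∧∣q∣≤∣p∣⇒p≡q {p = p} {q = q} p⊆q ∣q∣≤∣p∣ = ⊆-antisym p⊆q q⊆p
  where
  q⊆p : q ⊆ p
  q⊆p {x} x∈q = decidable-stable (x ∈ₛ? p)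
    (λ x∉p → <⇒≱ (p⊂q⇒∣p∣<∣q∣ (p⊆q , x , x∈q , x∉p)) ∣q∣≤∣p∣)

x∈p⇒⁅x⁆⊆p : x ∈ₛ p → ⁅ x ⁆ ⊆ p
x∈p⇒⁅x⁆⊆p {p = p} x∈p y∈⁅x⁆ = subst (_∈ₛ p) (sym (x∈⁅y⁆⇒x≡y _ y∈⁅x⁆)) x∈p

∪-⊆ : p ⊆ f → q ⊆ f → p ∪ q ⊆ f
∪-⊆ p⊆f q⊆f x∈p∪q = [ p⊆f , q⊆f ] (x∈p∪q⁻ _ _ x∈p∪q)

∈-pairˡ : u ∈ₛ pair u v
∈-pairˡ = x∈p∪q⁺ (inj₁ (x∈⁅x⁆ _))

∈-pairʳ : v ∈ₛ pair u v
∈-pairʳ = x∈p∪q⁺ (inj₂ (x∈⁅x⁆ _))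

∉-pair : x ≢ u → x ≢ v → x ∉ₛ pair u v
∉-pair x≢u x≢v x∈uv = [ x≢y⇒x∉⁅y⁆ x≢u , x≢y⇒x∉⁅y⁆ x≢v ] (x∈p∪q⁻ _ _ x∈uv)

∣pair∣≡2 : u ≢ v → ∣ pair u v ∣ ≡ 2
∣pair∣≡2 {u = u} {v = v} u≢v =
  trans (∣⁅x⁆∪p∣≡1+∣p∣ u ⁅ v ⁆ (x≢y⇒x∉⁅y⁆ u≢v)) (cong suc (∣⁅x⁆∣≡1 v))

∣triple∣≡3 : u ≢ v → u ≢ w → v ≢ w → ∣ triple u v w ∣ ≡ 3
∣triple∣≡3 {u = u} {v = v} {w = w} u≢v u≢w v≢w =
  trans (∣⁅x⁆∪p∣≡1+∣p∣ u (pair v w) (∉-pair u≢v u≢w)) (cong suc (∣pair∣≡2 v≢w))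

-- u is a junk value, returned only when f ⊆ pair u v.
third : Fin n → Fin n → Subset n → Fin n
third u v f with any? (λ x → x ∈ₛ? f ×-dec ¬? (x ∈ₛ? pair u v))
... | yes (w , _) = w
... | no _        = u

third-spec : (u v : Fin n) (f : Subset n) → ∣ pair u v ∣ < ∣ f ∣ →
             third u v f ∈ₛ f × third u v f ∉ₛ pair u v
third-spec u v f ∣uv∣<∣f∣ with any? (λ x → x ∈ₛ? f ×-dec ¬? (x ∈ₛ? pair u v))
... | yes (_ , w∈f , w∉uv) = w∈f , w∉uv
... | no ∄w = contradiction (p⊆q⇒∣p∣≤∣q∣ f⊆uv) (<⇒≱ ∣uv∣<∣f∣)
  where
  f⊆uv : f ⊆ pair u v
  f⊆uv {x} x∈f = decidable-stable (x ∈ₛ? pair u v) (λ x∉uv → ∄w (x , x∈f , x∉uv))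

triple-third : ∀ {n} {u v : Fin n} {f : Subset n} → u ≢ v → ∣ f ∣ ≡ 3 → pair u v ⊆ f → triple u v (third u v f) ≡ f
triple-third {n} {u} {v} {f} u≢v ∣f∣≡3 uv⊆f =
  p⊆q∧∣q∣≤∣p∣⇒p≡q uvz⊆f (≤-reflexive (trans ∣f∣≡3 (sym (∣triple∣≡3 u≢v u≢z v≢z))))
  where
  z : Fin n
  z = third u v f
  z-spec : z ∈ₛ f × z ∉ₛ pair u v
  z-spec = third-spec u v f (subst₂ _<_ (sym (∣pair∣≡2 u≢v)) (sym ∣f∣≡3) (n<1+n 2))
  u≢z : u ≢ z
  u≢z u≡z = proj₂ z-spec (subst (_∈ₛ pair u v) u≡z ∈-pairˡ)
  v≢z : v ≢ z
  v≢z v≡z = proj₂ z-spec (subst (_∈ₛ pair u v) v≡z ∈-pairʳ)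
  uvz⊆f : triple u v z ⊆ f
  uvz⊆f = ∪-⊆ (x∈p⇒⁅x⁆⊆p (uv⊆f ∈-pairˡ)) (∪-⊆ (x∈p⇒⁅x⁆⊆p (uv⊆f ∈-pairʳ)) (x∈p⇒⁅x⁆⊆p (proj₁ z-spec)))

module _ (H : ThreeGraph n) (u v : Fin n) where

  edgesThrough : List (Subset n)
  edgesThrough = filter (pair u v ⊆?_) (edges H)

  link : List (Fin n)
  link = map (third u v) edgesThrough

  length-link : length link ≡ degree H u v
  length-link = length-map (third u v) edgesThrough

  module _ (u≢v : u ≢ v) where

    map-triple-link : map (triple u v) link ≡ edgesThrough
    map-triple-link = begin
      map (triple u v) (map (third u v) edgesThrough) ≡⟨ map-∘ edgesThrough ⟨
      map (triple u v ∘ third u v) edgesThrough      ≡⟨ map-id-local (All.tabulate triple-third-through) ⟩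
      edgesThrough                                    ∎
      where
      open ≡-Reasoning
      triple-third-through : ∀ {f} → f ∈ edgesThrough → triple u v (third u v f) ≡ f
      triple-third-through f∈ with ∈-filter⁻ (pair u v ⊆?_) {xs = edges H} f∈
      ... | f∈H , uv⊆f = triple-third u≢v (All.lookup (size3 H) f∈H) uv⊆f

    link-unique : Unique link
    link-unique = map⁻ (subst Unique (sym map-triple-link) (filter⁺ (pair u v ⊆?_) (unique H)))

    ∈-link⇒triple∈edges : w ∈ link → triple u v w ∈ edges H
    ∈-link⇒triple∈edges {w = w} w∈link =
      proj₁ (∈-filter⁻ (pair u v ⊆?_) (subst (triple u v w ∈_) map-triple-link (∈-map⁺ (triple u v) w∈link)))

module _ {A : Set} (_≟_ : DecidableEquality A) where
  open DecMembership _≟_ using (_∈?_)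

  unique-longer⇒∃∉ : ∀ {xs ys : List A} → Unique ys → length xs < length ys →
                     ∃ λ y → y ∈ ys × y ∉ xs
  unique-longer⇒∃∉ {xs} {y ∷ ys} (y∉ys ∷ ys!) ∣xs∣<∣y∷ys∣ with y ∈? xs
  ... | no y∉xs = y , here refl , y∉xs
  ... | yes y∈xs with unique-longer⇒∃∉ {filter (¬? ∘ (_≟ y)) xs} ys! ∣xs-y∣<∣ys∣
    where
    ∣xs-y∣<∣ys∣ : length (filter (¬? ∘ (_≟ y)) xs) < length ys
    ∣xs-y∣<∣ys∣ = <-≤-trans (filter-notAll _ xs (Any.map (λ y≡x x≢y → x≢y (sym y≡x)) y∈xs)) (≤-pred ∣xs∣<∣y∷ys∣)
  ... | z , z∈ys , z∉xs-y = z , there z∈ys , λ z∈xs →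
        z∉xs-y (∈-filter⁺ (¬? ∘ (_≟ y)) z∈xs (λ z≡y → All.lookup y∉ys z∈ys (sym z≡y)))

  distinct-representatives : ∀ {k} (C : Fin k → List A) (D : List A) →
    (∀ x → Unique (C x)) → (∀ x → length D + k ≤ length (C x)) →
    Σ (Fin k → A) λ r → Injective _≡_ _≡_ r × (∀ x → r x ∈ C x × r x ∉ D)
  distinct-representatives {0} C D _ _ = (λ ()) , (λ { {()} }) , (λ ())
  distinct-representatives {suc k} C D C! ∣D∣+k≤∣C∣
    with unique-longer⇒∃∉ (C! zero) (<-≤-trans (m<m+n (length D) z<s) (∣D∣+k≤∣C∣ zero))
  ... | z , z∈C₀ , z∉D
    with distinct-representatives (C ∘ suc) (z ∷ D) (C! ∘ suc)
           (λ x → subst (_≤ length (C (suc x))) (+-suc (length D) k) (∣D∣+k≤∣C∣ (suc x)))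
  ... | r , r-inj , r-spec = r′ , r′-inj , r′-spec
    where
    r′ : Fin (suc k) → A
    r′ zero    = z
    r′ (suc x) = r x
    r′-inj : Injective _≡_ _≡_ r′
    r′-inj {zero}  {zero}  _  = refl
    r′-inj {zero}  {suc y} eq = contradiction (here (sym eq)) (proj₂ (r-spec y))
    r′-inj {suc x} {zero}  eq = contradiction (here eq) (proj₂ (r-spec x))
    r′-inj {suc x} {suc y} eq = cong suc (r-inj eq)
    r′-spec : ∀ x → r′ x ∈ C x × r′ x ∉ D
    r′-spec zero    = z∈C₀ , z∉D
    r′-spec (suc x) = proj₁ (r-spec x) , proj₂ (r-spec x) ∘ there

module _ {n s t : ℕ} {H : ThreeGraph n} (K : KstCopy s t H) where

  linkAt : Fin s × Fin t → List (Fin n)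
  linkAt (i , j) = link H (a K i) (b K j)

  linkAt-unique : ∀ ij → Unique (linkAt ij)
  linkAt-unique (i , j) = link-unique H (a K i) (b K j) (disj K i j)

  core : List (Fin n)
  core = tabulate (a K) ++ tabulate (b K)

  a∈core : ∀ i → a K i ∈ core
  a∈core i = ∈-++⁺ˡ (∈-tabulate⁺ i)

  b∈core : ∀ j → b K j ∈ core
  b∈core j = ∈-++⁺ʳ (tabulate (a K)) (∈-tabulate⁺ j)

  length-core : length core ≡ s + t
  length-core = trans (length-++ (tabulate (a K))) (cong₂ _+_ (length-tabulate (a K)) (length-tabulate (b K)))

  core+edges≤link : ∀ ij → length core + s * t ≤ length (linkAt ij)
  core+edges≤link (i , j) = begin
    length core + s * t ≡⟨ cong (_+ s * t) length-core ⟩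
    s + t + s * t       ≡⟨ +-comm (s + t) (s * t) ⟩
    s * t + (s + t)     ≡⟨ +-assoc (s * t) s t ⟨
    s * t + s + t       ≤⟨ proj₂ (adj K i j) ⟩
    degree H (a K i) (b K j) ≡⟨ length-link H (a K i) (b K j) ⟨
    length (linkAt (i , j)) ∎
    where open ≤-Reasoning

fact2p6 : (s t : ℕ) → 1 ≤ s → s ≤ t → (n : ℕ) (H : ThreeGraph n)
    → (K : KstCopy s t H) → Expansion H K
fact2p6 s t _ _ n H K
  with distinct-representatives _≟_ (linkAt K ∘ remQuot t) (core K)
         (linkAt-unique K ∘ remQuot t) (core+edges≤link K ∘ remQuot t)
... | r , r-inj , r-spec = record
  { c       = c
  ; c-inj   = λ i j i′ j′ → combine-injective i j i′ j′ ∘ r-inj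
  ; c-new-a = λ i j i′ c≡a → c∉core i j (subst (_∈ core K) (sym c≡a) (a∈core K i′))
  ; c-new-b = λ i j j′ c≡b → c∉core i j (subst (_∈ core K) (sym c≡b) (b∈core K j′))
  ; c-edge  = λ i j → ∈-link⇒triple∈edges H (a K i) (b K j) (disj K i j) (c∈link i j)
  }
  where
  c : Fin s → Fin t → Fin n
  c i j = r (combine i j)
  c∈link : ∀ i j → c i j ∈ linkAt K (i , j)
  c∈link i j = subst (c i j ∈_) (cong (linkAt K) (remQuot-combine i j)) (proj₁ (r-spec (combine i j)))
  c∉core : ∀ i j → c i j ∉ core K
  c∉core i j = proj₂ (r-spec (combine i j))
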